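{- Let $n\geq 1$ and $m\geq 1$ be integers. Then \[ \sum_{i_{1}+\cdots+i_{n}=m}\binom{m}{i_{1},\dots,i_{n}}\frac{1}{(i_{1}+1)\cdots(i_{n}+1)}=\frac{S(m+n,n)}{\binom{m+n}{n}}, \] where the sum runs over all $n$-tuples of nonnegative integers with $i_1+\cdots+i_n=m$ and $S(m+n,n)$ is the Stirling number of the second kind.
   Context: $\binom{m}{i_1,\dots,i_n}=\frac{m!}{i_1!\cdots i_n!}$ is the multinomial coefficient. $S(k,n)$ denotes the Stirling number of the second kind (the number of partitions of a $k$-element set into $n$ nonempty blocks). -}

module Defs where

open import Data.Nat.Base using (ℕ; zero; suc; _+_; _*_; _/_; _!; NonZero; _≤_; z≤n; s≤s)
open import Data.Nat.Properties using (_!≢0; m*n≢0; _≟_)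
open import Data.Nat.Combinatorics using (_C_; nCk+nC[k+1]≡[n+1]C[k+1])
open import Data.Vec.Base using (Vec; []; _∷_; foldr)
import Data.Vec.Base as Vec
open import Data.List.Base using (List; []; _∷_; concatMap; upTo; filter; map)
import Data.List.Base as List
open import Data.Integer.Base using (+_)
open import Data.Rational.Base using (ℚ; 0ℚ) renaming (_+_ to _+ℚ_; _/_ to _/ℚ_)
open import Relation.Binary.PropositionalEquality using (_≡_; refl; subst; sym)

S : ℕ → ℕ → ℕ
S zero    zero    = 1
S zero    (suc n) = 0
S (suc k) zero    = 0
S (suc k) (suc n) = suc n * S k (suc n) + S k n

tuples : (n b : ℕ) → List (Vec ℕ n)
tuples zero    b = [] ∷ []
tuples (suc n) b = concatMap (λ i → map (i ∷_) (tuples n b)) (upTo b)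

vsum : ∀ {n} → Vec ℕ n → ℕ
vsum = foldr _ _+_ 0

vprod : ∀ {n} → Vec ℕ n → ℕ
vprod = foldr _ _*_ 1

-- The index set of the sum: all n-tuples of nonnegative integers
-- (i₁,…,iₙ) with i₁+⋯+iₙ = m (each entry is then ≤ m).
compositions : (n m : ℕ) → List (Vec ℕ n)
compositions n m = filter (λ v → vsum v ≟ m) (tuples n (suc m))

prod!≢0 : ∀ {n} (v : Vec ℕ n) → NonZero (vprod (Vec.map _! v))
prod!≢0 []      = _
prod!≢0 (i ∷ v) = m*n≢0 (i !) (vprod (Vec.map _! v)) {{i !≢0}} {{prod!≢0 v}}

prodSuc≢0 : ∀ {n} (v : Vec ℕ n) → NonZero (vprod (Vec.map suc v))
prodSuc≢0 []      = _
prodSuc≢0 (i ∷ v) = m*n≢0 (suc i) (vprod (Vec.map suc v)) {{_}} {{prodSuc≢0 v}}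

private
  plus≢0 : ∀ a b → NonZero a → NonZero (a + b)
  plus≢0 (suc a) b _ = _

C≢0 : ∀ n k → k ≤ n → NonZero (n C k)
C≢0 n       zero    _         = _
C≢0 (suc n) (suc k) (s≤s k≤n) =
  subst NonZero (nCk+nC[k+1]≡[n+1]C[k+1] n k) (plus≢0 (n C k) (n C suc k) (C≢0 n k k≤n))

multinomial : ∀ {n} → ℕ → Vec ℕ n → ℕ
multinomial m v = (m ! / vprod (Vec.map _! v)) {{prod!≢0 v}}

term : ∀ {n} → ℕ → Vec ℕ n → ℚ
term m v = (+ multinomial m v /ℚ vprod (Vec.map suc v)) {{prodSuc≢0 v}}

sumℚ : List ℚ → ℚ
sumℚ = List.foldr _+ℚ_ 0ℚ

LHS : ℕ → ℕ → ℚ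
LHS n m = sumℚ (map (term m) (compositions n m))

private
  n≤m+n : ∀ m n → n ≤ m + n
  n≤m+n zero    zero    = z≤n
  n≤m+n zero    (suc n) = s≤s (n≤m+n zero n)
  n≤m+n (suc m) n       = Data.Nat.Properties.m≤n⇒m≤1+n (n≤m+n m n)
    where import Data.Nat.Properties

RHS : ℕ → ℕ → ℚ
RHS n m = (+ S (m + n) n /ℚ ((m + n) C n)) {{C≢0 (m + n) n (n≤m+n m n)}}

-- Clearing denominators, the summand equals  m! / ∏ (iₖ + 1)!, i.e. the
-- multinomial coefficient of m + n over (i₁ + 1, …, iₙ + 1) divided by
-- (m + n)! / m! = n! · C(m + n, n).  Summing these multinomials over all
-- compositions of m + n into n positive parts counts the surjections from an
-- (m + n)-set onto an n-set, which number n! · S(m + n, n).  That count is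
-- established by peeling off the first part, which leads to the binomial
-- convolution  Σ_{i + r = K} C(K, i) S(r, n) = S(K + 1, n + 1).

module Submission where

open import Data.Nat.Base
  using (ℕ; zero; suc; _+_; _*_; _∸_; _/_; _!; _≤_; _<_; _≥_; z≤n; s≤s; NonZero)
open import Data.Nat.Properties
open import Data.Nat.DivMod using (m*n/n≡m; m/n*n≡m)
open import Data.Nat.Combinatorics
  using (_C_; nCk+nC[k+1]≡[n+1]C[k+1]; k>n⇒nCk≡0; nCk≡n!/k![n-k]!; k![n∸k]!∣n!)
open import Data.Nat.ListAction using (sum)
open import Data.Nat.ListAction.Properties using (sum-++)
open import Data.Nat.Tactic.RingSolver using (solve-∀)
import Data.Integer.Base as ℤ
open import Data.Integer.Properties using (pos-*; pos-+)
import Data.Integer.Tactic.RingSolver as ℤ-Solver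
open import Data.Rational.Base using () renaming (_+_ to _+ℚ_; _/_ to _/ℚ_)
open import Data.Rational.Properties
  using (fromℚᵘ-cong; toℚᵘ-injective; toℚᵘ-homo-+; toℚᵘ-fromℚᵘ)
open import Data.Rational.Unnormalised.Base using (mkℚᵘ; *≡*)
open import Data.Rational.Unnormalised.Properties using (≃-trans; ≃-sym; +-cong)
open import Data.Vec.Base using (Vec; []; _∷_)
import Data.Vec.Base as Vec
open import Data.List.Base using (List; []; _∷_; _++_; map; filter; concatMap; applyUpTo; upTo)
open import Data.List.Properties using (filter-++; map-++; filter-≐; filter-none; map-cong-local)
import Data.List.Relation.Unary.All as All
open import Data.List.Relation.Unary.All.Properties using (all-filter)
open import Data.Product using (_,_)
open import Function using (_∘_)
open import Level using (0ℓ)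
open import Relation.Nullary using (Dec; yes; no)
open import Relation.Unary using (Pred; Decidable; _≐_)
open import Relation.Binary.PropositionalEquality
open ≡-Reasoning

open import Defs

sumAntidiagonal : ℕ → (ℕ → ℕ → ℕ) → ℕ
sumAntidiagonal zero    h = h 0 0
sumAntidiagonal (suc m) h = h 0 (suc m) + sumAntidiagonal m (λ i j → h (suc i) j)

sumAntidiagonal-cong : ∀ m {h g : ℕ → ℕ → ℕ} → (∀ i j → i + j ≡ m → h i j ≡ g i j) →
                       sumAntidiagonal m h ≡ sumAntidiagonal m g
sumAntidiagonal-cong zero    h≡g = h≡g 0 0 refl
sumAntidiagonal-cong (suc m) h≡g = cong₂ _+_ (h≡g 0 (suc m) refl)
  (sumAntidiagonal-cong m (λ i j i+j≡m → h≡g (suc i) j (cong suc i+j≡m)))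

sumAntidiagonal-+ : ∀ m (h g : ℕ → ℕ → ℕ) →
                    sumAntidiagonal m (λ i j → h i j + g i j) ≡ sumAntidiagonal m h + sumAntidiagonal m g
sumAntidiagonal-+ zero    h g = refl
sumAntidiagonal-+ (suc m) h g = begin
  a + b + sumAntidiagonal m (λ i j → h (suc i) j + g (suc i) j)
    ≡⟨ cong (a + b +_) (sumAntidiagonal-+ m _ _) ⟩
  a + b + (H + G)
    ≡⟨ interchange a b H G ⟩
  a + H + (b + G) ∎
  where
  a = h 0 (suc m)
  b = g 0 (suc m)
  H = sumAntidiagonal m (λ i j → h (suc i) j)
  G = sumAntidiagonal m (λ i j → g (suc i) j)
  interchange : ∀ a b c d → a + b + (c + d) ≡ a + c + (b + d)
  interchange = solve-∀

sumAntidiagonal-*ˡ : ∀ m c (h : ℕ → ℕ → ℕ) →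
                     sumAntidiagonal m (λ i j → c * h i j) ≡ c * sumAntidiagonal m h
sumAntidiagonal-*ˡ zero    c h = refl
sumAntidiagonal-*ˡ (suc m) c h = trans (cong (c * h 0 (suc m) +_) (sumAntidiagonal-*ˡ m c _))
  (sym (*-distribˡ-+ c (h 0 (suc m)) _))

sumAntidiagonal-suc : ∀ m (h : ℕ → ℕ → ℕ) →
                      sumAntidiagonal (suc m) h ≡ sumAntidiagonal m (λ i j → h i (suc j)) + h (suc m) 0
sumAntidiagonal-suc zero    h = refl
sumAntidiagonal-suc (suc m) h =
  trans (cong (h 0 (suc (suc m)) +_) (sumAntidiagonal-suc m (λ i j → h (suc i) j)))
        (sym (+-assoc (h 0 (suc (suc m))) _ _))

sumAntidiagonal-dropʳ : ∀ n m (h : ℕ → ℕ → ℕ) → (∀ i j → j < n → h i j ≡ 0) →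
                        sumAntidiagonal (m + n) h ≡ sumAntidiagonal m (λ i j → h i (j + n))
sumAntidiagonal-dropʳ zero m h _ =
  trans (cong (λ k → sumAntidiagonal k h) (+-identityʳ m))
        (sumAntidiagonal-cong m (λ i j _ → cong (h i) (sym (+-identityʳ j))))
sumAntidiagonal-dropʳ (suc n) m h h≡0 = begin
  sumAntidiagonal (m + suc n) h
    ≡⟨ cong (λ k → sumAntidiagonal k h) (+-suc m n) ⟩
  sumAntidiagonal (suc (m + n)) h
    ≡⟨ sumAntidiagonal-suc (m + n) h ⟩
  sumAntidiagonal (m + n) (λ i j → h i (suc j)) + h (suc (m + n)) 0
    ≡⟨ cong₂ _+_ (sumAntidiagonal-dropʳ n m _ (λ i j j<n → h≡0 i (suc j) (s≤s j<n)))
                 (h≡0 _ 0 (s≤s z≤n)) ⟩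
  sumAntidiagonal m (λ i j → h i (suc (j + n))) + 0
    ≡⟨ +-identityʳ _ ⟩
  sumAntidiagonal m (λ i j → h i (suc (j + n)))
    ≡⟨ sumAntidiagonal-cong m (λ i j _ → cong (h i) (sym (+-suc j n))) ⟩
  sumAntidiagonal m (λ i j → h i (j + suc n)) ∎

binomialTransform : ℕ → (ℕ → ℕ) → ℕ
binomialTransform K h = sumAntidiagonal K (λ i r → (K C i) * h r)

binomialTransform-+ : ∀ K (h g : ℕ → ℕ) →
                      binomialTransform K (λ r → h r + g r) ≡ binomialTransform K h + binomialTransform K g
binomialTransform-+ K h g =
  trans (sumAntidiagonal-cong K (λ i r _ → *-distribˡ-+ (K C i) (h r) (g r))) (sumAntidiagonal-+ K _ _)

binomialTransform-*ˡ : ∀ K c (h : ℕ → ℕ) →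
                       binomialTransform K (λ r → c * h r) ≡ c * binomialTransform K h
binomialTransform-*ˡ K c h =
  trans (sumAntidiagonal-cong K (λ i r _ → x*[y*z]≡y*[x*z] (K C i) c (h r))) (sumAntidiagonal-*ˡ K c _)
  where
  x*[y*z]≡y*[x*z] : ∀ x y z → x * (y * z) ≡ y * (x * z)
  x*[y*z]≡y*[x*z] = solve-∀

-- Pascal's rule splits C(K + 1, i) into C(K, i) and C(K, i - 1); the first
-- part is re-indexed by sumAntidiagonal-suc, its extra term C(K, K + 1) being 0.
binomialTransform-suc : ∀ K (h : ℕ → ℕ) →
                        binomialTransform (suc K) h ≡ binomialTransform K (h ∘ suc) + binomialTransform K h
binomialTransform-suc K h = begin
  sumAntidiagonal (suc K) (λ i r → (suc K C i) * h r)
    ≡⟨ sumAntidiagonal-cong (suc K) (λ i r _ → pascal i r) ⟩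
  sumAntidiagonal (suc K) (λ i r → upper i r + lower i r)
    ≡⟨ sumAntidiagonal-+ (suc K) upper lower ⟩
  sumAntidiagonal (suc K) upper + T
    ≡⟨ cong (_+ T) (sumAntidiagonal-suc K upper) ⟩
  T′ + (K C suc K) * h 0 + T
    ≡⟨ cong (λ c → T′ + c * h 0 + T) (k>n⇒nCk≡0 (n<1+n K)) ⟩
  T′ + 0 + T
    ≡⟨ cong (_+ T) (+-identityʳ T′) ⟩
  T′ + T ∎
  where
  T  = binomialTransform K h
  T′ = binomialTransform K (h ∘ suc)
  upper : ℕ → ℕ → ℕ
  upper i r = (K C i) * h r
  lower : ℕ → ℕ → ℕ
  lower zero    r = 0
  lower (suc i) r = (K C i) * h r
  pascal : ∀ i r → (suc K C i) * h r ≡ upper i r + lower i r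
  pascal zero    r = sym (+-identityʳ _)
  pascal (suc i) r =
    trans (cong (_* h r) (trans (sym (nCk+nC[k+1]≡[n+1]C[k+1] K i)) (+-comm (K C i) _)))
          (*-distribʳ-+ (h r) (K C suc i) (K C i))

r<n⇒S[r,n]≡0 : ∀ {r n} → r < n → S r n ≡ 0
r<n⇒S[r,n]≡0 {zero}  {suc n} _         = refl
r<n⇒S[r,n]≡0 {suc r} {suc n} (s≤s r<n) =
  trans (cong₂ _+_ (cong (suc n *_) (r<n⇒S[r,n]≡0 (m≤n⇒m≤1+n r<n))) (r<n⇒S[r,n]≡0 r<n))
        (trans (+-identityʳ (suc n * 0)) (*-zeroʳ (suc n)))

binomialTransform-S : ∀ K n → binomialTransform K (λ r → S r n) ≡ S (suc K) (suc n)
binomialTransform-S zero    n = trans (+-identityʳ (S 0 n)) (cong (_+ S 0 n) (sym (*-zeroʳ (suc n))))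
binomialTransform-S (suc K) n = begin
  binomialTransform (suc K) (λ r → S r n)
    ≡⟨ binomialTransform-suc K (λ r → S r n) ⟩
  binomialTransform K (λ r → S (suc r) n) + binomialTransform K (λ r → S r n)
    ≡⟨ cong (binomialTransform K (λ r → S (suc r) n) +_) (binomialTransform-S K n) ⟩
  binomialTransform K (λ r → S (suc r) n) + S (suc K) (suc n)
    ≡⟨ step n ⟩
  S (suc (suc K)) (suc n) ∎
  where
  step : ∀ n → binomialTransform K (λ r → S (suc r) n) + S (suc K) (suc n) ≡ S (suc (suc K)) (suc n)
  step zero = begin
    binomialTransform K (λ _ → 0) + S (suc K) 1
      ≡⟨ cong (_+ S (suc K) 1) (binomialTransform-*ˡ K 0 (λ _ → 0)) ⟩
    S (suc K) 1
      ≡⟨ sym (trans (+-identityʳ _) (+-identityʳ _)) ⟩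
    S (suc K) 1 + 0 + 0 ∎
  step (suc n) = begin
    binomialTransform K (λ r → suc n * S r (suc n) + S r n) + X
      ≡⟨ cong (_+ X) (binomialTransform-+ K _ _) ⟩
    binomialTransform K (λ r → suc n * S r (suc n)) + binomialTransform K (λ r → S r n) + X
      ≡⟨ cong (λ t → t + binomialTransform K (λ r → S r n) + X) (binomialTransform-*ˡ K (suc n) _) ⟩
    suc n * binomialTransform K (λ r → S r (suc n)) + binomialTransform K (λ r → S r n) + X
      ≡⟨ cong₂ (λ x y → suc n * x + y + X) (binomialTransform-S K (suc n)) (binomialTransform-S K n) ⟩
    suc n * X + Y + X
      ≡⟨ rearrange (suc n) X Y ⟩
    suc (suc n) * X + Y ∎
    where
    X = S (suc K) (suc (suc n))
    Y = S (suc K) (suc n)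
    rearrange : ∀ a x y → a * x + y + x ≡ suc a * x + y
    rearrange = solve-∀

-- The i = 0 term of the binomial transform is S(K, n), and the terms with
-- r < n vanish.
sumAntidiagonal-C-suc-S : ∀ n m →
  sumAntidiagonal m (λ i r → (suc (m + n) C suc i) * S (r + n) n) ≡ suc n * S (suc (m + n)) (suc n)
sumAntidiagonal-C-suc-S n m = begin
  sumAntidiagonal m (λ i r → h i (r + n))
    ≡⟨ sym (sumAntidiagonal-dropʳ n m h h-vanishes) ⟩
  sumAntidiagonal (m + n) h
    ≡⟨ +-cancelˡ-≡ (S K n) _ _ expansion ⟩
  suc n * S K (suc n) ∎
  where
  K = suc (m + n)
  h : ℕ → ℕ → ℕ
  h i r = (K C suc i) * S r n
  h-vanishes : ∀ i r → r < n → h i r ≡ 0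
  h-vanishes i r r<n = trans (cong ((K C suc i) *_) (r<n⇒S[r,n]≡0 r<n)) (*-zeroʳ (K C suc i))
  expansion : S K n + sumAntidiagonal (m + n) h ≡ S K n + suc n * S K (suc n)
  expansion = begin
    S K n + sumAntidiagonal (m + n) h
      ≡⟨ cong (_+ sumAntidiagonal (m + n) h) (sym (+-identityʳ (S K n))) ⟩
    binomialTransform K (λ r → S r n)
      ≡⟨ binomialTransform-S K n ⟩
    suc n * S K (suc n) + S K n
      ≡⟨ +-comm _ (S K n) ⟩
    S K n + suc n * S K (suc n) ∎

compositionSum : (n m : ℕ) → (Vec ℕ n → ℕ) → ℕ
compositionSum zero    zero    f = f []
compositionSum zero    (suc m) f = 0
compositionSum (suc n) m       f = sumAntidiagonal m (λ i r → compositionSum n r (f ∘ (i ∷_)))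

compositionSum-*ˡ : ∀ n m c (f : Vec ℕ n → ℕ) →
                    compositionSum n m (λ v → c * f v) ≡ c * compositionSum n m f
compositionSum-*ˡ zero    zero    c f = refl
compositionSum-*ˡ zero    (suc m) c f = sym (*-zeroʳ c)
compositionSum-*ˡ (suc n) m       c f =
  trans (sumAntidiagonal-cong m (λ i r _ → compositionSum-*ˡ n r c _)) (sumAntidiagonal-*ˡ m c _)

multinomial′ : ∀ {n} → ℕ → Vec ℕ n → ℕ
multinomial′ k []      = 1
multinomial′ k (j ∷ v) = (k C j) * multinomial′ (k ∸ j) v

nCk*[k!*[n∸k]!]≡n! : ∀ {n k} → k ≤ n → (n C k) * (k ! * (n ∸ k) !) ≡ n !
nCk*[k!*[n∸k]!]≡n! {n} {k} k≤n =
  trans (cong (_* (k ! * (n ∸ k) !)) (nCk≡n!/k![n-k]! k≤n))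
        (m/n*n≡m {{k !* (n ∸ k) !≢0}} (k![n∸k]!∣n! k≤n))

multinomial′*∏!≡! : ∀ {n} k (v : Vec ℕ n) → vsum v ≡ k →
                    multinomial′ k v * vprod (Vec.map _! v) ≡ k !
multinomial′*∏!≡! k []      refl = refl
multinomial′*∏!≡! k (j ∷ w) refl = begin
  ((j + s) C j) * multinomial′ (j + s ∸ j) w * (j ! * P)
    ≡⟨ cong (λ t → ((j + s) C j) * multinomial′ t w * (j ! * P)) (m+n∸m≡n j s) ⟩
  ((j + s) C j) * multinomial′ s w * (j ! * P)
    ≡⟨ rearrange ((j + s) C j) (multinomial′ s w) (j !) P ⟩
  ((j + s) C j) * (j ! * (multinomial′ s w * P))
    ≡⟨ cong (λ t → ((j + s) C j) * (j ! * t)) (multinomial′*∏!≡! s w refl) ⟩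
  ((j + s) C j) * (j ! * s !)
    ≡⟨ cong (λ t → ((j + s) C j) * (j ! * t !)) (sym (m+n∸m≡n j s)) ⟩
  ((j + s) C j) * (j ! * (j + s ∸ j) !)
    ≡⟨ nCk*[k!*[n∸k]!]≡n! (m≤m+n j s) ⟩
  (j + s) ! ∎
  where
  s = vsum w
  P = vprod (Vec.map _! w)
  rearrange : ∀ a b c d → a * b * (c * d) ≡ a * (c * (b * d))
  rearrange = solve-∀

multinomial≡multinomial′ : ∀ {n} m (v : Vec ℕ n) → vsum v ≡ m →
                           multinomial m v ≡ multinomial′ m v
multinomial≡multinomial′ m v vsum≡m =
  trans (cong (λ t → (t / vprod (Vec.map _! v)) {{prod!≢0 v}}) (sym (multinomial′*∏!≡! m v vsum≡m)))
        (m*n/n≡m (multinomial′ m v) (vprod (Vec.map _! v)) {{prod!≢0 v}})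

compositionSum-multinomial′-suc : ∀ n m →
  compositionSum n m (λ v → multinomial′ (m + n) (Vec.map suc v)) ≡ n ! * S (m + n) n
compositionSum-multinomial′-suc zero    zero    = refl
compositionSum-multinomial′-suc zero    (suc m) = refl
compositionSum-multinomial′-suc (suc n) m       = begin
  sumAntidiagonal m (λ i r → compositionSum n r (λ v → multinomial′ (m + suc n) (suc i ∷ Vec.map suc v)))
    ≡⟨ sumAntidiagonal-cong m firstPart ⟩
  sumAntidiagonal m (λ i r → n ! * ((suc (m + n) C suc i) * S (r + n) n))
    ≡⟨ sumAntidiagonal-*ˡ m (n !) _ ⟩
  n ! * sumAntidiagonal m (λ i r → (suc (m + n) C suc i) * S (r + n) n)
    ≡⟨ cong (n ! *_) (sumAntidiagonal-C-suc-S n m) ⟩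
  n ! * (suc n * S (suc (m + n)) (suc n))
    ≡⟨ x*[y*z]≡[y*x]*z (n !) (suc n) _ ⟩
  suc n ! * S (suc (m + n)) (suc n)
    ≡⟨ cong (λ k → suc n ! * S k (suc n)) (sym (+-suc m n)) ⟩
  suc n ! * S (m + suc n) (suc n) ∎
  where
  x*[y*z]≡[y*x]*z : ∀ x y z → x * (y * z) ≡ (y * x) * z
  x*[y*z]≡[y*x]*z = solve-∀
  x*[y*z]≡y*[x*z] : ∀ x y z → x * (y * z) ≡ y * (x * z)
  x*[y*z]≡y*[x*z] = solve-∀
  remaining : ∀ i r → i + r + suc n ∸ suc i ≡ r + n
  remaining i r = trans (cong (_∸ suc i) (+-suc (i + r) n))
    (trans (cong (_∸ i) (+-assoc i r n)) (m+n∸m≡n i (r + n)))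
  firstPart : ∀ i r → i + r ≡ m →
    compositionSum n r (λ v → multinomial′ (m + suc n) (suc i ∷ Vec.map suc v))
      ≡ n ! * ((suc (m + n) C suc i) * S (r + n) n)
  firstPart i r refl = begin
    compositionSum n r (λ v → c * multinomial′ (i + r + suc n ∸ suc i) (Vec.map suc v))
      ≡⟨ compositionSum-*ˡ n r c (λ v → multinomial′ (i + r + suc n ∸ suc i) (Vec.map suc v)) ⟩
    c * rest (i + r + suc n ∸ suc i)
      ≡⟨ cong₂ (λ c k → c * rest k) (cong (_C suc i) (+-suc (i + r) n)) (remaining i r) ⟩
    c′ * rest (r + n)
      ≡⟨ cong (c′ *_) (compositionSum-multinomial′-suc n r) ⟩
    c′ * (n ! * S (r + n) n)
      ≡⟨ x*[y*z]≡y*[x*z] c′ (n !) (S (r + n) n) ⟩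
    n ! * (c′ * S (r + n) n) ∎
    where
    c  = (i + r + suc n) C suc i
    c′ = suc (i + r + n) C suc i
    rest : ℕ → ℕ
    rest k = compositionSum n r (λ v → multinomial′ k (Vec.map suc v))

module _ {A B : Set} {P : Pred A 0ℓ} (P? : Decidable P) (f : A → ℕ) where

  sum-map-filter-concatMap : ∀ (g : B → List A) xs →
    sum (map f (filter P? (concatMap g xs))) ≡ sum (map (λ x → sum (map f (filter P? (g x)))) xs)
  sum-map-filter-concatMap g []       = refl
  sum-map-filter-concatMap g (x ∷ xs) = begin
    sum (map f (filter P? (g x ++ concatMap g xs)))
      ≡⟨ cong (sum ∘ map f) (filter-++ P? (g x) (concatMap g xs)) ⟩
    sum (map f (filter P? (g x) ++ filter P? (concatMap g xs)))
      ≡⟨ cong sum (map-++ f (filter P? (g x)) _) ⟩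
    sum (map f (filter P? (g x)) ++ map f (filter P? (concatMap g xs)))
      ≡⟨ sum-++ (map f (filter P? (g x))) _ ⟩
    sum (map f (filter P? (g x))) + sum (map f (filter P? (concatMap g xs)))
      ≡⟨ cong (sum (map f (filter P? (g x))) +_) (sum-map-filter-concatMap g xs) ⟩
    sum (map f (filter P? (g x))) + sum (map (λ x → sum (map f (filter P? (g x)))) xs) ∎

  sum-map-filter-map : ∀ (g : B → A) ys →
    sum (map f (filter P? (map g ys))) ≡ sum (map (f ∘ g) (filter (P? ∘ g) ys))
  sum-map-filter-map g []       = refl
  sum-map-filter-map g (y ∷ ys) with P? (g y)
  ... | yes _ = cong (f (g y) +_) (sum-map-filter-map g ys)
  ... | no  _ = sum-map-filter-map g ys

map-applyUpTo : ∀ {A B : Set} (f : A → B) (g : ℕ → A) n →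
                map f (applyUpTo g n) ≡ applyUpTo (f ∘ g) n
map-applyUpTo f g zero    = refl
map-applyUpTo f g (suc n) = cong (f (g 0) ∷_) (map-applyUpTo f (g ∘ suc) n)

sum-applyUpTo≡sumAntidiagonal : ∀ {m b} → m < b → (X : ℕ → ℕ) (h : ℕ → ℕ → ℕ) →
  (∀ i j → i + j ≡ m → X i ≡ h i j) → (∀ i → m < i → X i ≡ 0) →
  sum (applyUpTo X b) ≡ sumAntidiagonal m h
sum-applyUpTo≡sumAntidiagonal {zero} {suc b} _ X h X≡h X≡0 =
  trans (cong₂ _+_ (X≡h 0 0 refl) (sum-zero b (λ i → X≡0 (suc i) (s≤s z≤n)))) (+-identityʳ _)
  where
  sum-zero : ∀ b {Y : ℕ → ℕ} → (∀ i → Y i ≡ 0) → sum (applyUpTo Y b) ≡ 0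
  sum-zero zero    _    = refl
  sum-zero (suc b) Y≡0 = cong₂ _+_ (Y≡0 0) (sum-zero b (Y≡0 ∘ suc))
sum-applyUpTo≡sumAntidiagonal {suc m} {suc b} (s≤s m<b) X h X≡h X≡0 =
  cong₂ _+_ (X≡h 0 (suc m) refl)
    (sum-applyUpTo≡sumAntidiagonal m<b (X ∘ suc) (λ i j → h (suc i) j)
      (λ i j i+j≡m → X≡h (suc i) j (cong suc i+j≡m)) (λ i m<i → X≡0 (suc i) (s≤s m<i)))

sum-filter-tuples≡compositionSum : ∀ n {b m} → m < b → (f : Vec ℕ n → ℕ) →
  sum (map f (filter (λ v → vsum v ≟ m) (tuples n b))) ≡ compositionSum n m f
sum-filter-tuples≡compositionSum zero {m = zero}  _ f = +-identityʳ (f [])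
sum-filter-tuples≡compositionSum zero {m = suc m} _ f = refl
sum-filter-tuples≡compositionSum (suc n) {b} {m} m<b f = begin
  sum (map f (filter P? (concatMap (λ i → map (i ∷_) (tuples n b)) (upTo b))))
    ≡⟨ sum-map-filter-concatMap P? f (λ i → map (i ∷_) (tuples n b)) (upTo b) ⟩
  sum (map X (upTo b))
    ≡⟨ cong sum (map-applyUpTo X (λ i → i) b) ⟩
  sum (applyUpTo X b)
    ≡⟨ sum-applyUpTo≡sumAntidiagonal m<b X _ first≡i first>m ⟩
  compositionSum (suc n) m f ∎
  where
  P? : (v : Vec ℕ (suc n)) → Dec (vsum v ≡ m)
  P? v = vsum v ≟ m
  X : ℕ → ℕ
  X i = sum (map f (filter P? (map (i ∷_) (tuples n b))))
  first≡i : ∀ i r → i + r ≡ m → X i ≡ compositionSum n r (f ∘ (i ∷_))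
  first≡i i r i+r≡m = begin
    X i
      ≡⟨ sum-map-filter-map P? f (i ∷_) (tuples n b) ⟩
    sum (map (f ∘ (i ∷_)) (filter (P? ∘ (i ∷_)) (tuples n b)))
      ≡⟨ cong (sum ∘ map (f ∘ (i ∷_))) (filter-≐ (P? ∘ (i ∷_)) (λ w → vsum w ≟ r) tail≡r (tuples n b)) ⟩
    sum (map (f ∘ (i ∷_)) (filter (λ w → vsum w ≟ r) (tuples n b)))
      ≡⟨ sum-filter-tuples≡compositionSum n r<b _ ⟩
    compositionSum n r (f ∘ (i ∷_)) ∎
    where
    tail≡r : (λ w → i + vsum w ≡ m) ≐ (λ w → vsum w ≡ r)
    tail≡r = (λ i+w≡m → +-cancelˡ-≡ i _ _ (trans i+w≡m (sym i+r≡m)))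
           , (λ w≡r → trans (cong (i +_) w≡r) i+r≡m)
    r<b : r < b
    r<b = ≤-<-trans (m≤n+m r i) (subst (_< b) (sym i+r≡m) m<b)
  first>m : ∀ i → m < i → X i ≡ 0
  first>m i m<i = trans (sum-map-filter-map P? f (i ∷_) (tuples n b))
    (cong (sum ∘ map (f ∘ (i ∷_))) (filter-none (P? ∘ (i ∷_)) (All.universal i+w≢m (tuples n b))))
    where
    i+w≢m : ∀ w → i + vsum w ≢ m
    i+w≢m w i+w≡m = <⇒≢ (<-≤-trans m<i (m≤m+n i (vsum w))) (sym i+w≡m)

sum-compositions≡compositionSum : ∀ n m (f : Vec ℕ n → ℕ) →
  sum (map f (compositions n m)) ≡ compositionSum n m f
sum-compositions≡compositionSum n m = sum-filter-tuples≡compositionSum n ≤-refl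

vsum-map-suc : ∀ {n} (v : Vec ℕ n) → vsum (Vec.map suc v) ≡ vsum v + n
vsum-map-suc         []      = refl
vsum-map-suc {suc n} (i ∷ v) = begin
  suc (i + vsum (Vec.map suc v)) ≡⟨ cong (λ t → suc (i + t)) (vsum-map-suc v) ⟩
  suc (i + (vsum v + n))         ≡⟨ cong suc (sym (+-assoc i (vsum v) n)) ⟩
  suc (i + vsum v + n)           ≡⟨ sym (+-suc (i + vsum v) n) ⟩
  i + vsum v + suc n             ∎

∏!-map-suc : ∀ {n} (v : Vec ℕ n) →
             vprod (Vec.map _! (Vec.map suc v)) ≡ vprod (Vec.map suc v) * vprod (Vec.map _! v)
∏!-map-suc []      = refl
∏!-map-suc (i ∷ v) =
  trans (cong (suc i * i ! *_) (∏!-map-suc v)) (interchange (suc i) (i !) (vprod (Vec.map suc v)) _)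
  where
  interchange : ∀ a b c d → a * b * (c * d) ≡ a * c * (b * d)
  interchange = solve-∀

cross-multiply⇒/≡ : ∀ a b c d .{{_ : NonZero b}} .{{_ : NonZero d}} → a * d ≡ c * b →
                    ℤ.+ a /ℚ b ≡ ℤ.+ c /ℚ d
cross-multiply⇒/≡ a (suc b) c (suc d) ad≡cb = fromℚᵘ-cong {mkℚᵘ (ℤ.+ a) b} {mkℚᵘ (ℤ.+ c) d}
  (*≡* (trans (sym (pos-* a (suc d))) (trans (cong ℤ.+_ ad≡cb) (pos-* c (suc b)))))

/ℚ-+-/ℚ : ∀ a b d .{{_ : NonZero d}} → ℤ.+ a /ℚ d +ℚ ℤ.+ b /ℚ d ≡ ℤ.+ (a + b) /ℚ d
/ℚ-+-/ℚ a b (suc d) = toℚᵘ-injective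
  (≃-trans (toℚᵘ-homo-+ (ℤ.+ a /ℚ suc d) (ℤ.+ b /ℚ suc d))
  (≃-trans (+-cong (toℚᵘ-fromℚᵘ (mkℚᵘ (ℤ.+ a) d)) (toℚᵘ-fromℚᵘ (mkℚᵘ (ℤ.+ b) d)))
  (≃-trans (*≡* cross) (≃-sym (toℚᵘ-fromℚᵘ (mkℚᵘ (ℤ.+ (a + b)) d))))))
  where
  sd = suc d
  distrib : ∀ x y s → (x ℤ.* s ℤ.+ y ℤ.* s) ℤ.* s ≡ (x ℤ.+ y) ℤ.* (s ℤ.* s)
  distrib = ℤ-Solver.solve-∀
  cross : (ℤ.+ a ℤ.* ℤ.+ sd ℤ.+ ℤ.+ b ℤ.* ℤ.+ sd) ℤ.* ℤ.+ sd ≡ ℤ.+ (a + b) ℤ.* ℤ.+ (sd * sd)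
  cross = trans (distrib (ℤ.+ a) (ℤ.+ b) (ℤ.+ sd)) (sym (cong₂ ℤ._*_ (pos-+ a b) (pos-* sd sd)))

sumℚ-map-/ℚ : ∀ {A : Set} d .{{_ : NonZero d}} (f : A → ℕ) xs →
              sumℚ (map (λ x → ℤ.+ f x /ℚ d) xs) ≡ ℤ.+ sum (map f xs) /ℚ d
sumℚ-map-/ℚ d f []       = cross-multiply⇒/≡ 0 1 0 d refl
sumℚ-map-/ℚ d f (x ∷ xs) =
  trans (cong (ℤ.+ f x /ℚ d +ℚ_) (sumℚ-map-/ℚ d f xs)) (/ℚ-+-/ℚ (f x) (sum (map f xs)) d)

n!*[m+n]Cn≢0 : ∀ n m → NonZero (n ! * ((m + n) C n))
n!*[m+n]Cn≢0 n m = m*n≢0 (n !) ((m + n) C n) {{n !≢0}} {{C≢0 (m + n) n (m≤n+m n m)}}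

-- The common denominator n! · C(m + n, n) is (m + n)! / m!.
term≡multinomial′/ : ∀ {n} m (v : Vec ℕ n) → vsum v ≡ m →
  term m v ≡ (ℤ.+ multinomial′ (m + n) (Vec.map suc v) /ℚ (n ! * ((m + n) C n))) {{n!*[m+n]Cn≢0 n m}}
term≡multinomial′/ {n} m v vsum≡m =
  cross-multiply⇒/≡ (multinomial m v) Q M D {{prodSuc≢0 v}} {{n!*[m+n]Cn≢0 n m}}
    (*-cancelʳ-≡ _ _ P {{prod!≢0 v}} (begin
      multinomial m v * D * P
        ≡⟨ x*y*z≡x*z*y (multinomial m v) D P ⟩
      multinomial m v * P * D
        ≡⟨ cong (λ t → t * P * D) (multinomial≡multinomial′ m v vsum≡m) ⟩
      multinomial′ m v * P * D
        ≡⟨ cong (_* D) (multinomial′*∏!≡! m v vsum≡m) ⟩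
      m ! * (n ! * ((m + n) C n))
        ≡⟨ x*[y*z]≡z*[y*x] (m !) (n !) ((m + n) C n) ⟩
      ((m + n) C n) * (n ! * m !)
        ≡⟨ cong (λ t → ((m + n) C n) * (n ! * t !)) (sym (m+n∸n≡m m n)) ⟩
      ((m + n) C n) * (n ! * (m + n ∸ n) !)
        ≡⟨ nCk*[k!*[n∸k]!]≡n! (m≤n+m n m) ⟩
      (m + n) !
        ≡⟨ sym (multinomial′*∏!≡! (m + n) (Vec.map suc v) vsum-map-suc≡m+n) ⟩
      M * vprod (Vec.map _! (Vec.map suc v))
        ≡⟨ cong (M *_) (∏!-map-suc v) ⟩
      M * (Q * P)
        ≡⟨ sym (*-assoc M Q P) ⟩
      M * Q * P ∎))
  where
  D = n ! * ((m + n) C n)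
  P = vprod (Vec.map _! v)
  Q = vprod (Vec.map suc v)
  M = multinomial′ (m + n) (Vec.map suc v)
  vsum-map-suc≡m+n : vsum (Vec.map suc v) ≡ m + n
  vsum-map-suc≡m+n = trans (vsum-map-suc v) (cong (_+ n) vsum≡m)
  x*y*z≡x*z*y : ∀ x y z → x * y * z ≡ x * z * y
  x*y*z≡x*z*y = solve-∀
  x*[y*z]≡z*[y*x] : ∀ x y z → x * (y * z) ≡ z * (y * x)
  x*[y*z]≡z*[y*x] = solve-∀

-- The identity holds for all n and m.
lemma4p3 : (n m : ℕ) → n ≥ 1 → m ≥ 1 → LHS n m ≡ RHS n m
lemma4p3 n m _ _ = begin
  LHS n m
    ≡⟨ cong sumℚ (map-cong-local (All.map (λ {v} → term≡multinomial′/ m v)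
         (all-filter (λ v → vsum v ≟ m) (tuples n (suc m))))) ⟩
  sumℚ (map (λ v → ℤ.+ M v /ℚ D) (compositions n m))
    ≡⟨ sumℚ-map-/ℚ D M (compositions n m) ⟩
  ℤ.+ sum (map M (compositions n m)) /ℚ D
    ≡⟨ cong (λ t → ℤ.+ t /ℚ D)
         (trans (sum-compositions≡compositionSum n m M) (compositionSum-multinomial′-suc n m)) ⟩
  ℤ.+ (n ! * S (m + n) n) /ℚ D
    ≡⟨ cross-multiply⇒/≡ (n ! * S (m + n) n) D (S (m + n) n) ((m + n) C n)
         {{D≢0}} {{C≢0 (m + n) n (m≤n+m n m)}} (x*y*z≡y*[x*z] (n !) (S (m + n) n) ((m + n) C n)) ⟩
  RHS n m ∎
  where
  D = n ! * ((m + n) C n)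
  instance
    D≢0 : NonZero D
    D≢0 = n!*[m+n]Cn≢0 n m
  M : Vec ℕ n → ℕ
  M v = multinomial′ (m + n) (Vec.map suc v)
  x*y*z≡y*[x*z] : ∀ x y z → x * y * z ≡ y * (x * z)
  x*y*z≡y*[x*z] = solve-∀
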